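{- Let $G$ be a $4$-regular plane graph. Suppose that in the $2$-coloring of the faces of $G$ (in which any two faces sharing an edge get different colors), one of the two color classes consists only of triangles and a single pentagon. Then $\alpha(G)<\frac{|V(G)|}{3}$.
   Context: $\alpha(G)$ denotes the independence number of $G$, i.e., the maximum size of a set of pairwise non-adjacent vertices. -}

module Defs where

open import Data.Nat using (ℕ; zero; suc; _+_; _*_; _<_)
open import Data.Fin using (Fin; _≟_)
open import Data.Fin.Subset using (Subset; _∈_; ∣_∣)
open import Data.Fin.Permutation using (Permutation′; _⟨$⟩ʳ_)
open import Data.List using (List; length; filter; allFin)
open import Data.Bool using (Bool)
open import Data.Product using (Σ; ∃; ∃-syntax; _×_; _,_)
open import Relation.Nullary using (¬_)
open import Relation.Binary.PropositionalEquality using (_≡_; _≢_)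
open import Function.Bundles using (_⇔_)

iter : ∀ {n} → (Fin n → Fin n) → ℕ → Fin n → Fin n
iter f zero    x = x
iter f (suc k) x = f (iter f k x)

SameOrbit : ∀ {n} → (Fin n → Fin n) → Fin n → Fin n → Set
SameOrbit f d d' = ∃[ k ] iter f k d ≡ d'

data Reach {n} (σ α : Fin n → Fin n) (d : Fin n) : Fin n → Set where
  here  : Reach σ α d d
  stepσ : ∀ {e} → Reach σ α d e → Reach σ α d (σ e)
  stepα : ∀ {e} → Reach σ α d e → Reach σ α d (α e)

fibreSize : ∀ {n m} → (Fin n → Fin m) → Fin m → ℕ
fibreSize {n} g y = length (filter (λ x → g x ≟ y) (allFin n))

-- A connected plane graph given by a combinatorial map (rotation system)
-- on `darts` darts (half-edges):
--   σ : rotation of darts around their vertex,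
--   α : fixed-point-free involution pairing the two darts of an edge,
--   vertices = σ-orbits (indexed by Fin nV via `vert`),
--   faces    = (σ ∘ α)-orbits (indexed by Fin nF via `face`),
--   genus 0 (Euler's formula V - E + F = 2 with E = darts / 2).
record PlaneMap : Set where
  field
    darts : ℕ
    σ     : Permutation′ darts
    α     : Permutation′ darts
    α-inv : ∀ d → α ⟨$⟩ʳ (α ⟨$⟩ʳ d) ≡ d
    α-fpf : ∀ d → α ⟨$⟩ʳ d ≢ d
    nV    : ℕ
    vert  : Fin darts → Fin nV
    vert-surj  : ∀ x → ∃[ d ] vert d ≡ x
    vert-orbit : ∀ d d' → (vert d ≡ vert d') ⇔ SameOrbit (σ ⟨$⟩ʳ_) d d'
    nF    : ℕ
    face  : Fin darts → Fin nF
    face-surj  : ∀ F → ∃[ d ] face d ≡ F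
    face-orbit : ∀ d d' → (face d ≡ face d')
                   ⇔ SameOrbit (λ e → σ ⟨$⟩ʳ (α ⟨$⟩ʳ e)) d d'
    connected : ∀ d d' → Reach (σ ⟨$⟩ʳ_) (α ⟨$⟩ʳ_) d d'
    euler : 2 * (nV + nF) ≡ darts + 4

  head : Fin darts → Fin nV
  head d = vert (α ⟨$⟩ʳ d)

  Adj : Fin nV → Fin nV → Set
  Adj x y = ∃[ d ] (vert d ≡ x × head d ≡ y)

  Simple : Set
  Simple = (∀ d → vert d ≢ head d)
         × (∀ d d' → vert d ≡ vert d' → head d ≡ head d' → d ≡ d')

  degree : Fin nV → ℕ
  degree = fibreSize vert

  FourRegular : Set
  FourRegular = ∀ x → degree x ≡ 4

  faceLength : Fin nF → ℕ
  faceLength = fibreSize face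

  -- proper 2-colouring of faces: the two faces on the two sides of every
  -- edge (faces of the darts d and α d) get different colours
  ProperFaceColouring : (Fin nF → Bool) → Set
  ProperFaceColouring c = ∀ d → c (face d) ≢ c (face (α ⟨$⟩ʳ d))

  TrianglesAndOnePentagon : (Fin nF → Bool) → Bool → Set
  TrianglesAndOnePentagon c b =
    Σ (Fin nF) λ P → c P ≡ b × faceLength P ≡ 5
      × (∀ F → c F ≡ b → F ≢ P → faceLength F ≡ 3)

  Independent : Subset nV → Set
  Independent S = ∀ x y → x ∈ S → y ∈ S → ¬ Adj x y

module Submission where

-- Colour the faces so that the pentagon is black. Every edge borders exactly one black face, and
-- around each (4-valent) vertex the colours alternate, so exactly half of the 4|V| darts and half
-- of the 4|S| darts at vertices of S lie on black faces. Consecutive corners of a face are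
-- adjacent, so S occupies at most ⌊ℓ/2⌋ corners of a black face of length ℓ: at most one of a
-- triangle, two of the pentagon. With t black faces this gives 2|V| = 3t + 2 and 2|S| ≤ t + 1,
-- whence 6|S| ≤ 2|V| + 1; as 2|V| + 1 = 3(t + 1) is odd, 6|S| ≤ 2|V| − 2.

open import Defs
open import Data.Nat using (ℕ; zero; suc; _+_; _*_; _≤_; _<_; z≤n; s≤s)
open import Data.Nat.Properties hiding (_≟_)
open import Data.Nat.Tactic.RingSolver using (solve-∀)
open import Data.Bool using (Bool; true; false)
import Data.Bool as Bool
open import Data.Fin using (Fin; zero; suc; _≟_)
open import Data.Fin.Subset using (Subset; ∣_∣)
open import Data.Fin.Permutation using (Permutation′; _⟨$⟩ʳ_; _∘ₚ_)
open import Data.List using (length; filter; tabulate)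
open import Data.Vec using ([]; _∷_; lookup)
open import Data.Vec.Properties using (lookup⇒[]=)
open import Data.Product using (Σ; _×_; _,_)
open import Data.Empty using (⊥; ⊥-elim)
open import Function using (_∘_; id)
open import Function.Bundles using (Equivalence)
open import Relation.Nullary using (does; yes; no)
open import Relation.Binary.PropositionalEquality
open import Algebra.Properties.Semiring.Sum +-*-semiring
  using (sum; sum-cong-≗; ∑-distrib-+; ∑-comm; ∑-permute; *-distribˡ-sum)

𝟙 : Bool → ℕ
𝟙 true  = 1
𝟙 false = 0

𝟙-disjoint : ∀ {a b} → (a ≡ true → b ≡ true → ⊥) → 𝟙 a + 𝟙 b ≤ 1
𝟙-disjoint {true}  {true}  both = ⊥-elim (both refl refl)
𝟙-disjoint {true}  {false} _    = ≤-refl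
𝟙-disjoint {false} {b}     _    = 𝟙≤1 b
  where
  𝟙≤1 : ∀ b → 𝟙 b ≤ 1
  𝟙≤1 true  = ≤-refl
  𝟙≤1 false = z≤n

𝟙-≟-complement : ∀ {x y} b → x ≢ y → 𝟙 (does (x Bool.≟ b)) + 𝟙 (does (y Bool.≟ b)) ≡ 1
𝟙-≟-complement {true}  {true}  b     x≢y = ⊥-elim (x≢y refl)
𝟙-≟-complement {false} {false} b     x≢y = ⊥-elim (x≢y refl)
𝟙-≟-complement {true}  {false} true  _   = refl
𝟙-≟-complement {true}  {false} false _   = refl
𝟙-≟-complement {false} {true}  true  _   = refl
𝟙-≟-complement {false} {true}  false _   = refl

δ : ∀ {n} → Fin n → Fin n → ℕ
δ x y = 𝟙 (does (x ≟ y))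

δ-sym : ∀ {n} (x y : Fin n) → δ x y ≡ δ y x
δ-sym x y with x ≟ y | y ≟ x
... | yes _   | yes _   = refl
... | no _    | no _    = refl
... | yes x≡y | no y≢x = ⊥-elim (y≢x (sym x≡y))
... | no x≢y  | yes y≡x = ⊥-elim (x≢y (sym y≡x))

δ-suc : ∀ {n} (x y : Fin n) → δ (suc x) (suc y) ≡ δ x y
δ-suc x y with x ≟ y
... | yes refl = refl
... | no _     = refl

δ-*-subst : ∀ {n} (x y : Fin n) (f : Fin n → ℕ) → δ x y * f x ≡ δ x y * f y
δ-*-subst x y f with x ≟ y
... | yes refl = refl
... | no _     = refl

sum-const : ∀ n k → sum {n} (λ _ → k) ≡ n * k
sum-const zero    k = refl
sum-const (suc n) k = cong (k +_) (sum-const n k)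

sum-mono-≤ : ∀ {n} {f g : Fin n → ℕ} → (∀ i → f i ≤ g i) → sum f ≤ sum g
sum-mono-≤ {zero}  f≤g = z≤n
sum-mono-≤ {suc n} f≤g = +-mono-≤ (f≤g zero) (sum-mono-≤ (f≤g ∘ suc))

sum-*ˡ : ∀ {n} k (f : Fin n → ℕ) → sum (λ i → k * f i) ≡ k * sum f
sum-*ˡ k f = sym (*-distribˡ-sum k f)

sum-δ : ∀ {n} (x : Fin n) → sum (δ x) ≡ 1
sum-δ {suc n} zero    = cong suc (trans (sum-const n 0) (*-zeroʳ n))
sum-δ {suc n} (suc x) = trans (sum-cong-≗ (δ-suc x)) (sum-δ x)

sum-δʳ : ∀ {n} (y : Fin n) → sum (λ x → δ x y) ≡ 1
sum-δʳ y = trans (sum-cong-≗ (λ x → δ-sym x y)) (sum-δ y)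

∣p∣≡sum : ∀ {n} (p : Subset n) → ∣ p ∣ ≡ sum (𝟙 ∘ lookup p)
∣p∣≡sum []          = refl
∣p∣≡sum (true ∷ p)  = cong suc (∣p∣≡sum p)
∣p∣≡sum (false ∷ p) = ∣p∣≡sum p

fibreSum : ∀ {n m} → (Fin n → Fin m) → (Fin n → ℕ) → Fin m → ℕ
fibreSum g h y = sum (λ x → δ (g x) y * h x)

sum≡sum-fibreSum : ∀ {n m} (g : Fin n → Fin m) (h : Fin n → ℕ) → sum h ≡ sum (fibreSum g h)
sum≡sum-fibreSum g h = begin
  sum h                                      ≡⟨ sum-cong-≗ (λ x → sym (δ-sum-weight (g x) (h x))) ⟩
  sum (λ x → sum (λ y → δ (g x) y * h x))    ≡⟨ ∑-comm (λ x y → δ (g x) y * h x) ⟩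
  sum (fibreSum g h)                         ∎
  where
  open ≡-Reasoning
  δ-sum-weight : ∀ {m} (x : Fin m) k → sum (λ y → δ x y * k) ≡ k
  δ-sum-weight x k = begin
    sum (λ y → δ x y * k)  ≡⟨ sum-cong-≗ (λ y → *-comm (δ x y) k) ⟩
    sum (λ y → k * δ x y)  ≡⟨ sum-*ˡ k (δ x) ⟩
    k * sum (δ x)          ≡⟨ cong (k *_) (sum-δ x) ⟩
    k * 1                  ≡⟨ *-identityʳ k ⟩
    k                      ∎

fibreSize≡fibreSum : ∀ {n m} (g : Fin n → Fin m) y → fibreSize g y ≡ fibreSum g (λ _ → 1) y
fibreSize≡fibreSum {n} g y = trans (length-filter {n} id) (sum-cong-≗ {n} (λ x → sym (*-identityʳ _)))
  where
  length-filter : ∀ {k} (f : Fin k → Fin n) →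
    length (filter (λ x → g x ≟ y) (tabulate f)) ≡ sum (λ i → δ (g (f i)) y)
  length-filter {zero}  f = refl
  length-filter {suc k} f with g (f zero) ≟ y
  ... | yes _ = cong suc (length-filter (f ∘ suc))
  ... | no _  = length-filter (f ∘ suc)

sum-*-∘ : ∀ {n m} (g : Fin n → Fin m) (h : Fin n → ℕ) (f : Fin m → ℕ) →
          sum (λ x → h x * f (g x)) ≡ sum (λ y → f y * fibreSum g h y)
sum-*-∘ {n} g h f = trans (sum≡sum-fibreSum g _) (sum-cong-≗ λ y → begin
  sum (λ x → δ (g x) y * (h x * f (g x)))  ≡⟨ sum-cong-≗ {n} (λ x → transport x y) ⟩
  sum (λ x → f y * (δ (g x) y * h x))      ≡⟨ sum-*ˡ (f y) (λ x → δ (g x) y * h x) ⟩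
  f y * fibreSum g h y                     ∎)
  where
  open ≡-Reasoning
  rotate : ∀ a b c → a * (b * c) ≡ c * (a * b)
  rotate = solve-∀
  transport : ∀ x y → δ (g x) y * (h x * f (g x)) ≡ f y * (δ (g x) y * h x)
  transport x y = begin
    δ (g x) y * (h x * f (g x))  ≡⟨ δ-*-subst (g x) y (λ z → h x * f z) ⟩
    δ (g x) y * (h x * f y)      ≡⟨ rotate (δ (g x) y) (h x) (f y) ⟩
    f y * (δ (g x) y * h x)      ∎

sum-∘ : ∀ {n m} (g : Fin n → Fin m) (f : Fin m → ℕ) →
        sum (f ∘ g) ≡ sum (λ y → fibreSize g y * f y)
sum-∘ g f = begin
  sum (f ∘ g)                                       ≡⟨ sum-cong-≗ (λ x → sym (*-identityˡ (f (g x)))) ⟩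
  sum (λ x → 1 * f (g x))                           ≡⟨ sum-*-∘ g (λ _ → 1) f ⟩
  sum (λ y → f y * fibreSum g (λ _ → 1) y)          ≡⟨ sum-cong-≗ (λ y → *-comm (f y) _) ⟩
  sum (λ y → fibreSum g (λ _ → 1) y * f y)          ≡⟨ sum-cong-≗ (λ y → cong (_* f y) (sym (fibreSize≡fibreSum g y))) ⟩
  sum (λ y → fibreSize g y * f y)                   ∎
  where open ≡-Reasoning

half-≤ : ∀ {m} k → 2 * m ≤ suc (2 * k) → m ≤ k
half-≤ {m} k 2m≤2k+1 = ≤-pred (*-cancelˡ-< 2 m (suc k) (begin-strict
  2 * m              ≤⟨ 2m≤2k+1 ⟩
  suc (2 * k)        <⟨ n<1+n _ ⟩
  suc (suc (2 * k))  ≡⟨ *-distribˡ-+ 2 1 k ⟨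
  2 * suc k          ∎))
  where open ≤-Reasoning

2*sum≡sum-+-permute : ∀ {n} (π : Permutation′ n) (f : Fin n → ℕ) →
                      2 * sum f ≡ sum (λ i → f i + f (π ⟨$⟩ʳ i))
2*sum≡sum-+-permute π f = begin
  2 * sum f                           ≡⟨ cong (sum f +_) (+-identityʳ (sum f)) ⟩
  sum f + sum f                       ≡⟨ cong (sum f +_) (∑-permute f π) ⟩
  sum f + sum (λ i → f (π ⟨$⟩ʳ i))    ≡⟨ ∑-distrib-+ f (λ i → f (π ⟨$⟩ʳ i)) ⟨
  sum (λ i → f i + f (π ⟨$⟩ʳ i))      ∎
  where open ≡-Reasoning

2*m≡4*n⇒m≡2*n : ∀ {m n} → 2 * m ≡ 4 * n → m ≡ 2 * n
2*m≡4*n⇒m≡2*n {m} {n} eq = *-cancelˡ-≡ m (2 * n) 2 (trans eq (*-assoc 2 2 n))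

3*s<V : ∀ {V s t} → 2 * V ≡ 3 * t + 2 → 2 * s ≤ t + 1 → 3 * s < V
3*s<V {V} {s} {t} 2V≡3t+2 2s≤t+1 with m≤n⇒∃[o]m+o≡n 2s≤t+1
... | k , 2s+k≡t+1 = from-slack k (begin-equality
  suc (2 * V)        ≡⟨ cong suc 2V≡3t+2 ⟩
  suc (3 * t + 2)    ≡⟨ 3[x+1] t ⟨
  3 * (t + 1)        ≡⟨ cong (3 *_) 2s+k≡t+1 ⟨
  3 * (2 * s + k)    ∎)
  where
  open ≤-Reasoning
  3[x+1] : ∀ x → 3 * (x + 1) ≡ suc (3 * x + 2)
  3[x+1] = solve-∀
  2*3≡3*2 : ∀ x → 2 * (3 * x) ≡ 3 * (2 * x + 0)
  2*3≡3*2 = solve-∀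
  3[2x+1] : ∀ x → suc (2 * suc (3 * x)) ≡ 3 * (2 * x + 1)
  3[2x+1] = solve-∀
  -- Zero slack contradicts parity; positive slack gives 2V + 1 ≥ 6s + 3.
  from-slack : ∀ k → suc (2 * V) ≡ 3 * (2 * s + k) → 3 * s < V
  from-slack zero    eq = ⊥-elim (even≢odd (3 * s) V (trans (2*3≡3*2 s) (sym eq)))
  from-slack (suc k) eq = *-cancelˡ-≤ 2 (≤-pred (begin
    suc (2 * suc (3 * s))  ≡⟨ 3[2x+1] s ⟩
    3 * (2 * s + 1)        ≤⟨ *-monoʳ-≤ 3 (+-monoʳ-≤ (2 * s) (s≤s z≤n)) ⟩
    3 * (2 * s + suc k)    ≡⟨ eq ⟨
    suc (2 * V)            ∎))

module PlaneMapProperties (G : PlaneMap) where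
  open PlaneMap G

  φ : Fin darts → Fin darts
  φ d = σ ⟨$⟩ʳ (α ⟨$⟩ʳ d)

  vert-σ : ∀ d → vert (σ ⟨$⟩ʳ d) ≡ vert d
  vert-σ d = sym (Equivalence.from (vert-orbit d (σ ⟨$⟩ʳ d)) (1 , refl))

  vert-φ : ∀ d → vert (φ d) ≡ head d
  vert-φ d = vert-σ (α ⟨$⟩ʳ d)

  face-φ : ∀ d → face (φ d) ≡ face d
  face-φ d = sym (Equivalence.from (face-orbit d (φ d)) (1 , refl))

  face-σ : ∀ d → face (σ ⟨$⟩ʳ d) ≡ face (α ⟨$⟩ʳ d)
  face-σ d = trans (cong (λ e → face (σ ⟨$⟩ʳ e)) (sym (α-inv d))) (face-φ (α ⟨$⟩ʳ d))

  sum-vertexWeight : FourRegular → (w : Fin nV → ℕ) → sum (λ d → w (vert d)) ≡ 4 * sum w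
  sum-vertexWeight regular w = begin
    sum (λ d → w (vert d))             ≡⟨ sum-∘ vert w ⟩
    sum (λ v → degree v * w v)         ≡⟨ sum-cong-≗ (λ v → cong (_* w v) (regular v)) ⟩
    sum (λ v → 4 * w v)                ≡⟨ sum-*ˡ 4 w ⟩
    4 * sum w                          ∎
    where open ≡-Reasoning

  darts≡4*nV : FourRegular → darts ≡ 4 * nV
  darts≡4*nV regular = begin
    darts                       ≡⟨ *-identityʳ darts ⟨
    darts * 1                   ≡⟨ sum-const darts 1 ⟨
    sum {darts} (λ _ → 1)       ≡⟨ sum-vertexWeight regular (λ _ → 1) ⟩
    4 * sum {nV} (λ _ → 1)      ≡⟨ cong (4 *_) (trans (sum-const nV 1) (*-identityʳ nV)) ⟩
    4 * nV                      ∎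
    where open ≡-Reasoning

  corners : Subset nV → Fin nF → ℕ
  corners S = fibreSum face (λ d → 𝟙 (lookup S (vert d)))

  module _ {S : Subset nV} (independent : Independent S) where

    consecutive-corners : ∀ d → 𝟙 (lookup S (vert d)) + 𝟙 (lookup S (vert (φ d))) ≤ 1
    consecutive-corners d = 𝟙-disjoint λ d∈S φd∈S →
      independent (vert d) (head d) (lookup⇒[]= (vert d) S d∈S)
        (lookup⇒[]= (head d) S (trans (cong (lookup S) (sym (vert-φ d))) φd∈S)) (d , refl , refl)

    2*corners≤faceLength : ∀ F → 2 * corners S F ≤ faceLength F
    2*corners≤faceLength F = begin
      2 * corners S F                                ≡⟨ 2*sum≡sum-+-permute (α ∘ₚ σ) f ⟩
      sum (λ d → f d + f (φ d))                      ≡⟨ sum-cong-≗ (λ d → cong (λ e → f d + δ e F * s (φ d)) (face-φ d)) ⟩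
      sum (λ d → δ (face d) F * s d + δ (face d) F * s (φ d))
        ≡⟨ sum-cong-≗ (λ d → *-distribˡ-+ (δ (face d) F) (s d) (s (φ d))) ⟨
      sum (λ d → δ (face d) F * (s d + s (φ d)))     ≤⟨ sum-mono-≤ (λ d → *-monoʳ-≤ (δ (face d) F) (consecutive-corners d)) ⟩
      fibreSum face (λ _ → 1) F                      ≡⟨ fibreSize≡fibreSum face F ⟨
      faceLength F                                   ∎
      where
      open ≤-Reasoning
      s : Fin darts → ℕ
      s d = 𝟙 (lookup S (vert d))
      f : Fin darts → ℕ
      f d = δ (face d) F * s d

  onColour : (Fin nF → Bool) → Bool → Fin nF → ℕ
  onColour c b F = 𝟙 (does (c F Bool.≟ b))

  module _ {c : Fin nF → Bool} (proper : ProperFaceColouring c) (b : Bool) where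

    onColour-α : ∀ d → onColour c b (face d) + onColour c b (face (α ⟨$⟩ʳ d)) ≡ 1
    onColour-α d = 𝟙-≟-complement b (proper d)

    onColour-σ : ∀ d → onColour c b (face d) + onColour c b (face (σ ⟨$⟩ʳ d)) ≡ 1
    onColour-σ d = trans (cong (λ F → onColour c b (face d) + onColour c b F) (face-σ d)) (onColour-α d)

    2*darts-on-colour≡darts : 2 * sum (λ d → onColour c b (face d)) ≡ darts
    2*darts-on-colour≡darts = begin
      2 * sum (λ d → onColour c b (face d))     ≡⟨ 2*sum≡sum-+-permute α (λ d → onColour c b (face d)) ⟩
      sum (λ d → onColour c b (face d) + onColour c b (face (α ⟨$⟩ʳ d)))
                                                ≡⟨ sum-cong-≗ onColour-α ⟩
      sum {darts} (λ _ → 1)                     ≡⟨ sum-const darts 1 ⟩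
      darts * 1                                 ≡⟨ *-identityʳ darts ⟩
      darts                                     ∎
      where open ≡-Reasoning

    2*vertexWeight-on-colour : (w : Fin nV → ℕ) →
      2 * sum (λ d → w (vert d) * onColour c b (face d)) ≡ sum (λ d → w (vert d))
    2*vertexWeight-on-colour w =
      trans (2*sum≡sum-+-permute σ (λ d → w (vert d) * onColour c b (face d))) (sum-cong-≗ {darts} λ d → begin
      w (vert d) * onColour c b (face d) + w (vert (σ ⟨$⟩ʳ d)) * onColour c b (face (σ ⟨$⟩ʳ d))
        ≡⟨ cong (λ v → w (vert d) * onColour c b (face d) + w v * onColour c b (face (σ ⟨$⟩ʳ d))) (vert-σ d) ⟩
      w (vert d) * onColour c b (face d) + w (vert d) * onColour c b (face (σ ⟨$⟩ʳ d))
        ≡⟨ *-distribˡ-+ (w (vert d)) _ _ ⟨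
      w (vert d) * (onColour c b (face d) + onColour c b (face (σ ⟨$⟩ʳ d)))
        ≡⟨ cong (w (vert d) *_) (onColour-σ d) ⟩
      w (vert d) * 1
        ≡⟨ *-identityʳ (w (vert d)) ⟩
      w (vert d) ∎)
      where open ≡-Reasoning

  module _ {c : Fin nF → Bool} {b : Bool} {P : Fin nF} (c[P]≡b : c P ≡ b) (|P|≡5 : faceLength P ≡ 5)
           (triangles : ∀ F → c F ≡ b → F ≢ P → faceLength F ≡ 3) where

    faceLength-on-colour : ∀ F → faceLength F * onColour c b F ≡ 3 * onColour c b F + 2 * δ F P
    faceLength-on-colour F with F ≟ P | c F Bool.≟ b
    ... | yes refl | yes _      = cong (_* 1) |P|≡5
    ... | yes refl | no c[P]≢b = ⊥-elim (c[P]≢b c[P]≡b)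
    ... | no F≢P   | yes c[F]≡b = cong (_* 1) (triangles F c[F]≡b F≢P)
    ... | no _     | no _       = *-zeroʳ (faceLength F)

    corners-on-colour : ∀ {S} → Independent S →
      ∀ F → onColour c b F * corners S F ≤ onColour c b F + δ F P
    corners-on-colour {S} independent F with F ≟ P | c F Bool.≟ b
    ... | yes refl | yes _      = ≤-trans (≤-reflexive (*-identityˡ _))
      (half-≤ 2 (subst (2 * corners S P ≤_) |P|≡5 (2*corners≤faceLength independent P)))
    ... | yes refl | no c[P]≢b = ⊥-elim (c[P]≢b c[P]≡b)
    ... | no F≢P   | yes c[F]≡b = ≤-trans (≤-reflexive (*-identityˡ _))
      (half-≤ 1 (subst (2 * corners S F ≤_) (triangles F c[F]≡b F≢P) (2*corners≤faceLength independent F)))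
    ... | no _     | no _       = z≤n

    darts-on-colour≡3t+2 : sum (λ d → onColour c b (face d)) ≡ 3 * sum (onColour c b) + 2
    darts-on-colour≡3t+2 = begin
      sum (λ d → onColour c b (face d))                        ≡⟨ sum-∘ face (onColour c b) ⟩
      sum (λ F → faceLength F * onColour c b F)                ≡⟨ sum-cong-≗ faceLength-on-colour ⟩
      sum (λ F → 3 * onColour c b F + 2 * δ F P)               ≡⟨ ∑-distrib-+ (λ F → 3 * onColour c b F) (λ F → 2 * δ F P) ⟩
      sum (λ F → 3 * onColour c b F) + sum (λ F → 2 * δ F P)   ≡⟨ cong₂ _+_ (sum-*ˡ 3 (onColour c b)) (sum-*ˡ 2 (λ F → δ F P)) ⟩
      3 * sum (onColour c b) + 2 * sum (λ F → δ F P)           ≡⟨ cong (λ n → 3 * sum (onColour c b) + 2 * n) (sum-δʳ P) ⟩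
      3 * sum (onColour c b) + 2                               ∎
      where open ≡-Reasoning

    cornerDarts-on-colour≤t+1 : ∀ {S} → Independent S →
      sum (λ d → 𝟙 (lookup S (vert d)) * onColour c b (face d)) ≤ sum (onColour c b) + 1
    cornerDarts-on-colour≤t+1 {S} independent = begin
      sum (λ d → 𝟙 (lookup S (vert d)) * onColour c b (face d))
        ≡⟨ sum-*-∘ face (λ d → 𝟙 (lookup S (vert d))) (onColour c b) ⟩
      sum (λ F → onColour c b F * corners S F)       ≤⟨ sum-mono-≤ (corners-on-colour independent) ⟩
      sum (λ F → onColour c b F + δ F P)             ≡⟨ ∑-distrib-+ (onColour c b) (λ F → δ F P) ⟩
      sum (onColour c b) + sum (λ F → δ F P)         ≡⟨ cong (sum (onColour c b) +_) (sum-δʳ P) ⟩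
      sum (onColour c b) + 1                         ∎
      where open ≤-Reasoning

lemma1 : (G : PlaneMap) → let open PlaneMap G in
    Simple → FourRegular →
    Σ (Fin nF → Bool) (λ c → ProperFaceColouring c × Σ Bool (λ b → TrianglesAndOnePentagon c b)) →
    (S : Subset nV) → Independent S → 3 * ∣ S ∣ < nV
lemma1 G _ regular (c , proper , b , P , c[P]≡b , |P|≡5 , triangles) S independent =
  3*s<V {nV} {∣ S ∣} (trans (sym Y≡2*nV) (darts-on-colour≡3t+2 c[P]≡b |P|≡5 triangles))
        (subst (_≤ _) X≡2*∣S∣ (cornerDarts-on-colour≤t+1 c[P]≡b |P|≡5 triangles independent))
  where
  open PlaneMap G
  open PlaneMapProperties G
  Y≡2*nV : sum (λ d → onColour c b (face d)) ≡ 2 * nV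
  Y≡2*nV = 2*m≡4*n⇒m≡2*n {n = nV} (trans (2*darts-on-colour≡darts {c = c} proper b) (darts≡4*nV regular))
  X≡2*∣S∣ : sum (λ d → 𝟙 (lookup S (vert d)) * onColour c b (face d)) ≡ 2 * ∣ S ∣
  X≡2*∣S∣ = 2*m≡4*n⇒m≡2*n {n = ∣ S ∣} (begin
    2 * sum (λ d → 𝟙 (lookup S (vert d)) * onColour c b (face d))  ≡⟨ 2*vertexWeight-on-colour {c = c} proper b (𝟙 ∘ lookup S) ⟩
    sum (λ d → 𝟙 (lookup S (vert d)))                               ≡⟨ sum-vertexWeight regular (𝟙 ∘ lookup S) ⟩
    4 * sum (𝟙 ∘ lookup S)                                           ≡⟨ cong (4 *_) (∣p∣≡sum S) ⟨
    4 * ∣ S ∣                                                        ∎)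
    where open ≡-Reasoning
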